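{- Let $G$ be a complete wheel with $n\geq7$ vertices, with cycle $C=\{c_1,\dots,c_{n-1}\}$ and central vertex $h$. A set $L\subseteq C$ is an AP-landmark set for parameter $k=3$ if and only if it satisfies the following condition: for every $i$, if $c_i\notin L$ then $c_{i-4},c_{i-3},c_{i-2},c_{i-1},c_{i+1},c_{i+2},c_{i+3},c_{i+4}\in L$. Moreover, $md_3^{AP}(G)=\lfloor 4n/5\rfloor$.
   Context: The complete wheel on $n$ vertices has vertex set $V=C\cup\{h\}$ with $C=\{c_1,\dots,c_{n-1}\}$, edges $\{c_i,h\}$ and $\{c_i,c_{i+1}\}$ for $1\le i\le n-1$; cycle indices are taken modulo $n-1$. $d(x,y)$ denotes graph distance; $\tau$ separates distinct $u,v$ if $d(u,\tau)\neq d(v,\tau)$. $L\subseteq V$ is an AP-landmark set for parameter $k$ if every pair of distinct $u,v\in V$ is separated by at least $k$ distinct vertices of $L$; $md_k^{AP}(G)$ is the minimum cardinality of such a set. -}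

module Defs where

open import Data.Nat using (ℕ; zero; suc; _+_; _∸_; _≤_; _<_)
open import Data.Nat.DivMod using (_mod_)
open import Data.Fin using (Fin; zero; suc; toℕ)
open import Data.Fin.Subset using (Subset; _∈_; _∉_)
open import Data.Product using (_×_; ∃; Σ)
open import Data.Sum using (_⊎_)
open import Data.Empty using (⊥)
open import Data.Unit using (⊤)
open import Relation.Nullary using (¬_)
open import Relation.Binary.PropositionalEquality using (_≡_; _≢_)
open import Function.Definitions using (Injective)

-- Complete wheel with cycle length m (so n = suc m vertices).
-- Vertex set Fin (suc m): zero is the hub h, suc i is the cycle vertex c_i
-- (cycle vertices indexed 0 .. m-1).
V : ℕ → Set
V m = Fin (suc m)

hub : ∀ {m} → V m
hub = zero

-- cycle vertex with index x taken modulo m (degenerate for m = 0)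
cyc : (m : ℕ) → ℕ → V m
cyc zero    _ = zero
cyc (suc k) x = suc (x mod suc k)

Adj : (m : ℕ) → V m → V m → Set
Adj m zero    zero    = ⊥
Adj m zero    (suc j) = ⊤
Adj m (suc i) zero    = ⊤
Adj m (suc i) (suc j) = (cyc m (suc (toℕ i)) ≡ suc j) ⊎ (cyc m (suc (toℕ j)) ≡ suc i)

data Walk (m : ℕ) : V m → V m → ℕ → Set where
  here : ∀ {u} → Walk m u u 0
  step : ∀ {u w v k} → Adj m u w → Walk m w v k → Walk m u v (suc k)

IsDist : (m : ℕ) → V m → V m → ℕ → Set
IsDist m u v k = Walk m u v k × (∀ j → j < k → ¬ Walk m u v j)

Separates : (m : ℕ) → V m → V m → V m → Set
Separates m τ u v = ∀ a b → IsDist m u τ a → IsDist m v τ b → a ≢ b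

IsAPLandmark : (m k : ℕ) → Subset (suc m) → Set
IsAPLandmark m k L =
  ∀ (u v : V m) → u ≢ v →
    Σ (Fin k → V m) λ f → Injective _≡_ _≡_ f ×
      (∀ t → (f t ∈ L) × Separates m (f t) u v)

IsMdAP : (m k d : ℕ) → Set
IsMdAP m k d =
  (Σ (Subset (suc m)) λ L → IsAPLandmark m k L × Data.Fin.Subset.∣ L ∣ ≡ d) ×
  (∀ (L : Subset (suc m)) → IsAPLandmark m k L → d ≤ Data.Fin.Subset.∣ L ∣)

-- the combinatorial condition: if c_i ∉ L then c_{i±j} ∈ L for 1 ≤ j ≤ 4
-- (c_{i-j} is written c_{i + (m - j)}, valid since m > 4 in the theorem)
Cond : (m : ℕ) → Subset (suc m) → Set
Cond m L = ∀ (i : Fin m) → suc i ∉ L → ∀ j → 1 ≤ j → j ≤ 4 →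
  (cyc m (toℕ i + j) ∈ L) × (cyc m (toℕ i + (m ∸ j)) ∈ L)

module Submission where

-- Distances in the wheel are 0, 1 or 2, so a vertex τ separates u and v exactly
-- when its distances to them differ; the hub separates no two cycle vertices.
-- Call L spread when no two cycle vertices at cyclic distance 1, …, 4 are both
-- missing from L; this is the condition Cond of the theorem.
--  * Sufficiency: for spread L every pair u ≠ v has four candidate separators in
--    five consecutive cycle vertices (or three plus two, when u and v are far
--    apart); at most one per such stretch is missing, so three remain in L.
--  * Necessity: if c_y and c_{y+e} (1 ≤ e ≤ 4) are both missing, some pair of
--    cycle vertices has all its separators among four vertices including these
--    two, hence at most two separators in L (pigeonhole).
--  * Counting: for spread L each window of five consecutive cycle vertices holds
--    at most one gap; summing over all M windows gives 5·#gaps ≤ M, so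
--    |L| ≥ M - ⌊M/5⌋ = ⌊4(M+1)/5⌋, and leaving out c_0, c_5, c_10, … attains this.

open import Defs
open import Data.Nat using (ℕ; zero; suc; _+_; _*_; _∸_; _≤_; _<_; z≤n; s≤s; z<s; _%_; _/_; _≤?_; s≤s⁻¹)
open import Data.Nat.Properties
open import Data.Nat.DivMod
open import Algebra.Properties.CommutativeSemigroup +-commutativeSemigroup using (interchange)
open import Data.Nat.Divisibility using (divides)
open import Data.Nat.Tactic.RingSolver using (solve-∀)
open import Data.Fin using (Fin; zero; suc; toℕ) renaming (_<_ to _<ᶠ_)
open import Data.Fin.Properties
  using (pigeonhole; toℕ-fromℕ<; toℕ-injective; toℕ<n) renaming (suc-injective to Fin-suc-injective)
open import Data.Bool using (Bool; true; false)
open import Data.Vec using (Vec; []; _∷_; lookup; tabulate)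
open import Data.Vec.Properties using ([]=⇒lookup; lookup⇒[]=; lookup∘tabulate)
open import Data.Fin.Subset using (Subset; _∈_; _∉_; ∣_∣)
open import Data.Fin.Subset.Properties using (_∈?_; ∣p∣≤∣x∷p∣)
open import Data.Product using (_×_; _,_; ∃; ∃₂; Σ; proj₁; proj₂)
open import Data.Sum using (_⊎_; inj₁; inj₂; swap)
open import Data.Empty using (⊥; ⊥-elim)
open import Relation.Nullary using (¬_; Dec; yes; no)
open import Relation.Nullary.Decidable using (True; toWitness)
open import Relation.Binary.PropositionalEquality
open import Relation.Binary.Definitions using (tri<; tri≈; tri>)
open import Function.Definitions using (Injective)

by-evaluation : ∀ {a b} {_ : True (a ≤? b)} → a ≤ b
by-evaluation {_} {_} {a≤b} = toWitness a≤b

no-three-in-two : ∀ {A : Set} {a b : A} (f : Fin 3 → A) → Injective _≡_ _≡_ f →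
                  (∀ t → f t ≡ a ⊎ f t ≡ b) → ⊥
no-three-in-two {A} {a} {b} f f-injective choice =
  conclude (pigeonhole by-evaluation (λ t → side (choice t)))
  where
  side : ∀ {x : A} → x ≡ a ⊎ x ≡ b → Fin 2
  side (inj₁ _) = zero
  side (inj₂ _) = suc zero

  agree : ∀ {x y} (p : x ≡ a ⊎ x ≡ b) (q : y ≡ a ⊎ y ≡ b) → side p ≡ side q → x ≡ y
  agree (inj₁ x≡a) (inj₁ y≡a) _ = trans x≡a (sym y≡a)
  agree (inj₂ x≡b) (inj₂ y≡b) _ = trans x≡b (sym y≡b)
  agree (inj₁ _) (inj₂ _) ()
  agree (inj₂ _) (inj₁ _) ()

  conclude : ∃₂ (λ i j → i <ᶠ j × side (choice i) ≡ side (choice j)) → ⊥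
  conclude (i , j , i<j , same-side) =
    <⇒≢ i<j (cong toℕ (f-injective (agree (choice i) (choice j) same-side)))

sum< : ℕ → (ℕ → ℕ) → ℕ
sum< zero    f = 0
sum< (suc n) f = f 0 + sum< n (λ s → f (suc s))

sum<-cong : ∀ n {f g : ℕ → ℕ} → (∀ s → s < n → f s ≡ g s) → sum< n f ≡ sum< n g
sum<-cong zero    f≡g = refl
sum<-cong (suc n) f≡g =
  cong₂ _+_ (f≡g 0 z<s) (sum<-cong n (λ s s<n → f≡g (suc s) (s≤s s<n)))

sum<-mono : ∀ n {f g : ℕ → ℕ} → (∀ s → f s ≤ g s) → sum< n f ≤ sum< n g
sum<-mono zero    f≤g = z≤n
sum<-mono (suc n) f≤g = +-mono-≤ (f≤g 0) (sum<-mono n (λ s → f≤g (suc s)))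

sum<-const : ∀ n c → sum< n (λ _ → c) ≡ n * c
sum<-const zero    c = refl
sum<-const (suc n) c = cong (c +_) (sum<-const n c)

sum<-+ : ∀ n (f g : ℕ → ℕ) → sum< n (λ s → f s + g s) ≡ sum< n f + sum< n g
sum<-+ zero    f g = refl
sum<-+ (suc n) f g = begin
  f 0 + g 0 + sum< n (λ s → f (suc s) + g (suc s))
    ≡⟨ cong (f 0 + g 0 +_) (sum<-+ n (λ s → f (suc s)) (λ s → g (suc s))) ⟩
  f 0 + g 0 + (sum< n (λ s → f (suc s)) + sum< n (λ s → g (suc s)))
    ≡⟨ interchange (f 0) (g 0) _ _ ⟩
  f 0 + sum< n (λ s → f (suc s)) + (g 0 + sum< n (λ s → g (suc s))) ∎
  where open ≡-Reasoning

sum<-swap : ∀ a b (g : ℕ → ℕ → ℕ) →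
            sum< a (λ s → sum< b (g s)) ≡ sum< b (λ j → sum< a (λ s → g s j))
sum<-swap zero    b g = sym (trans (sum<-const b 0) (*-zeroʳ b))
sum<-swap (suc a) b g = begin
  sum< b (g 0) + sum< a (λ s → sum< b (g (suc s)))
    ≡⟨ cong (sum< b (g 0) +_) (sum<-swap a b (λ s → g (suc s))) ⟩
  sum< b (g 0) + sum< b (λ j → sum< a (λ s → g (suc s) j))
    ≡⟨ sum<-+ b (g 0) (λ j → sum< a (λ s → g (suc s) j)) ⟨
  sum< b (λ j → g 0 j + sum< a (λ s → g (suc s) j)) ∎
  where open ≡-Reasoning

sum<-shift : ∀ n (f : ℕ → ℕ) → sum< n (λ s → f (suc s)) + f 0 ≡ sum< n f + f n
sum<-shift zero    f = refl
sum<-shift (suc n) f = begin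
  f 1 + sum< n (λ s → f (suc (suc s))) + f 0
    ≡⟨ rearrange (f 1) _ (f 0) ⟩
  f 0 + (sum< n (λ s → f (suc (suc s))) + f 1)
    ≡⟨ cong (f 0 +_) (sum<-shift n (λ s → f (suc s))) ⟩
  f 0 + (sum< n (λ s → f (suc s)) + f (suc n))
    ≡⟨ +-assoc (f 0) _ _ ⟨
  f 0 + sum< n (λ s → f (suc s)) + f (suc n) ∎
  where
  open ≡-Reasoning
  rearrange : ∀ a b c → a + b + c ≡ c + (b + a)
  rearrange = solve-∀

sum<-rotate : ∀ n (f : ℕ → ℕ) → (∀ s → f (s + n) ≡ f s) →
              ∀ j → sum< n (λ s → f (s + j)) ≡ sum< n f
sum<-rotate n f periodic zero    = sum<-cong n (λ s _ → cong f (+-identityʳ s))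
sum<-rotate n f periodic (suc j) = begin
  sum< n (λ s → f (s + suc j)) ≡⟨ sum<-cong n (λ s _ → cong f (+-suc s j)) ⟩
  sum< n (λ s → f (suc s + j)) ≡⟨ +-cancelʳ-≡ (f j) _ _ drop-last ⟩
  sum< n (λ s → f (s + j))     ≡⟨ sum<-rotate n f periodic j ⟩
  sum< n f                     ∎
  where
  open ≡-Reasoning
  -- f (n + j) = f j closes the cycle
  drop-last : sum< n (λ s → f (suc s + j)) + f j ≡ sum< n (λ s → f (s + j)) + f j
  drop-last = trans (sum<-shift n (λ s → f (s + j)))
                    (cong (sum< n (λ s → f (s + j)) +_) (trans (cong f (+-comm n j)) (periodic j)))

uncovered : Bool → ℕ
uncovered true  = 0
uncovered false = 1

size+uncovered : ∀ {n} (p : Vec Bool n) (g : ℕ → Bool) → (∀ i → g (toℕ i) ≡ lookup p i) →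
                 ∣ p ∣ + sum< n (λ s → uncovered (g s)) ≡ n
size+uncovered []            g g≡p = refl
size+uncovered (true  ∷ p) g g≡p rewrite g≡p zero =
  cong suc (size+uncovered p (λ s → g (suc s)) (λ i → g≡p (suc i)))
size+uncovered (false ∷ p) g g≡p rewrite g≡p zero =
  trans (+-suc ∣ p ∣ _) (cong suc (size+uncovered p (λ s → g (suc s)) (λ i → g≡p (suc i))))

four-fifths : ∀ K → (4 * suc K) / 5 + K / 5 ≡ K
four-fifths 0 = refl
four-fifths 1 = refl
four-fifths 2 = refl
four-fifths 3 = refl
four-fifths 4 = refl
four-fifths (suc (suc (suc (suc (suc K))))) = begin
  (4 * suc (5 + K)) / 5 + (5 + K) / 5
    ≡⟨ cong₂ _+_ (cong (_/ 5) (expand K)) (m/n≡1+[m∸n]/n {5 + K} {5} (m≤m+n 5 K)) ⟩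
  (20 + 4 * suc K) / 5 + suc (K / 5)
    ≡⟨ cong (_+ suc (K / 5)) (+-distrib-/-∣ˡ (4 * suc K) {5} (divides 4 refl)) ⟩
  4 + (4 * suc K) / 5 + suc (K / 5)
    ≡⟨ regroup ((4 * suc K) / 5) (K / 5) ⟩
  5 + ((4 * suc K) / 5 + K / 5)
    ≡⟨ cong (5 +_) (four-fifths K) ⟩
  5 + K ∎
  where
  open ≡-Reasoning
  expand : ∀ K → 4 * suc (5 + K) ≡ 20 + 4 * suc K
  expand = solve-∀
  regroup : ∀ a b → 4 + a + suc b ≡ 5 + (a + b)
  regroup = solve-∀

-- A cycle vertex is named by any
-- natural number, read modulo M; most statements fix a base z and talk about the
-- vertices cv (z + a) for offsets a < M.
module Cycle (k : ℕ) where

  M : ℕ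
  M = suc k

  cv : ℕ → V M
  cv = cyc M

  toℕ-mod : ∀ x → toℕ (x mod M) ≡ x % M
  toℕ-mod x = toℕ-fromℕ< (m%n<n x M)

  cv-cong : ∀ a b → a % M ≡ b % M → cv a ≡ cv b
  cv-cong a b a≡b = cong suc (toℕ-injective
    (trans (toℕ-mod a) (trans a≡b (sym (toℕ-mod b)))))

  cv-injective : ∀ a b → cv a ≡ cv b → a % M ≡ b % M
  cv-injective a b cv-a≡cv-b = trans (sym (toℕ-mod a))
    (trans (cong toℕ (Fin-suc-injective cv-a≡cv-b)) (toℕ-mod b))

  +-congˡ-mod : ∀ a b c → a % M ≡ b % M → (a + c) % M ≡ (b + c) % M
  +-congˡ-mod a b c a≡b = begin
    (a + c) % M           ≡⟨ %-distribˡ-+ a c M ⟩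
    (a % M + c % M) % M   ≡⟨ cong (λ t → (t + c % M) % M) a≡b ⟩
    (b % M + c % M) % M   ≡⟨ %-distribˡ-+ b c M ⟨
    (b + c) % M           ∎
    where open ≡-Reasoning

  +-congʳ-mod : ∀ c a b → a % M ≡ b % M → (c + a) % M ≡ (c + b) % M
  +-congʳ-mod c a b a≡b =
    trans (cong (_% M) (+-comm c a)) (trans (+-congˡ-mod a b c a≡b) (cong (_% M) (+-comm b c)))

  cv-+M : ∀ y → cv (y + M) ≡ cv y
  cv-+M y = cv-cong (y + M) y ([m+n]%n≡m%n y M)

  cv-reduce : ∀ y e → cv (y % M + e) ≡ cv (y + e)
  cv-reduce y e = cv-cong (y % M + e) (y + e) (+-congˡ-mod (y % M) y e (m%n%n≡m%n y M))

  suc≡cv : ∀ (t : Fin M) → suc t ≡ cv (toℕ t)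
  suc≡cv t = cong suc (toℕ-injective
    (sym (trans (toℕ-mod (toℕ t)) (m<n⇒m%n≡m (toℕ<n t)))))

  -- the vertex at offset a from x is also at offset a + 1 from x + k, i.e. from x - 1
  cv-rebase : ∀ x a → cv (x + a) ≡ cv (x + k + suc a)
  cv-rebase x a = trans (sym (cv-+M (x + a))) (cong cv (shuffle x a k))
    where
    shuffle : ∀ x a k → x + a + suc k ≡ x + k + suc a
    shuffle = solve-∀

  cv-wrap : ∀ x o d (t : Fin M) → o + d ≡ M → suc t ≡ cv (x + o) → cv (toℕ t + d) ≡ cv (x + 0)
  cv-wrap x o d t o+d≡M t≡x+o = begin
    cv (toℕ t + d)         ≡⟨ cong (λ i → cv (toℕ i + d)) (Fin-suc-injective t≡x+o) ⟩
    cv (toℕ ((x + o) mod M) + d) ≡⟨ cong (λ r → cv (r + d)) (toℕ-mod (x + o)) ⟩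
    cv ((x + o) % M + d)   ≡⟨ cv-reduce (x + o) d ⟩
    cv (x + o + d)         ≡⟨ cong cv (trans (+-assoc x o d) (cong (x +_) o+d≡M)) ⟩
    cv (x + M)             ≡⟨ cv-+M x ⟩
    cv x                   ≡⟨ cong cv (+-identityʳ x) ⟨
    cv (x + 0)             ∎
    where open ≡-Reasoning

  +-undo : ∀ z x → (z + x + (M ∸ z % M)) % M ≡ x % M
  +-undo z x = begin
    (z + x + (M ∸ z % M)) % M    ≡⟨ cong (_% M) (regroup z x (M ∸ z % M)) ⟩
    (x + (M ∸ z % M) + z) % M    ≡⟨ +-congʳ-mod (x + (M ∸ z % M)) (z % M) z (m%n%n≡m%n z M) ⟨
    (x + (M ∸ z % M) + z % M) % M ≡⟨ cong (_% M) (+-assoc x _ (z % M)) ⟩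
    (x + (M ∸ z % M + z % M)) % M ≡⟨ cong (λ t → (x + t) % M) (m∸n+n≡m (<⇒≤ (m%n<n z M))) ⟩
    (x + M) % M                  ≡⟨ [m+n]%n≡m%n x M ⟩
    x % M                        ∎
    where
    open ≡-Reasoning
    regroup : ∀ z x w → z + x + w ≡ x + w + z
    regroup = solve-∀

  offset-injective : ∀ z {a b} → a < M → b < M → cv (z + a) ≡ cv (z + b) → a ≡ b
  offset-injective z {a} {b} a<M b<M same = begin
    a                          ≡⟨ m<n⇒m%n≡m a<M ⟨
    a % M                      ≡⟨ +-undo z a ⟨
    (z + a + (M ∸ z % M)) % M  ≡⟨ +-congˡ-mod (z + a) (z + b) (M ∸ z % M) (cv-injective (z + a) (z + b) same) ⟩
    (z + b + (M ∸ z % M)) % M  ≡⟨ +-undo z b ⟩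
    b % M                      ≡⟨ m<n⇒m%n≡m b<M ⟩
    b                          ∎
    where open ≡-Reasoning

  offset-distinct : ∀ z {a b} → a < b → b < M → cv (z + a) ≢ cv (z + b)
  offset-distinct z a<b b<M same = <⇒≢ a<b (offset-injective z (<-trans a<b b<M) b<M same)

  offset-surjective : ∀ z (t : Fin M) → ∃ λ o → o < M × suc t ≡ cv (z + o)
  offset-surjective z t = o , m%n<n (toℕ t + (M ∸ z % M)) M , trans (suc≡cv t) (cv-cong (toℕ t) (z + o) (sym z+o≡t))
    where
    o : ℕ
    o = (toℕ t + (M ∸ z % M)) % M
    open ≡-Reasoning
    z+o≡t : (z + o) % M ≡ toℕ t % M
    z+o≡t = begin
      (z + o) % M                       ≡⟨ +-congʳ-mod z _ (toℕ t + (M ∸ z % M)) (m%n%n≡m%n (toℕ t + (M ∸ z % M)) M) ⟩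
      (z + (toℕ t + (M ∸ z % M))) % M   ≡⟨ cong (_% M) (+-assoc z (toℕ t) _) ⟨
      (z + toℕ t + (M ∸ z % M)) % M     ≡⟨ +-undo z (toℕ t) ⟩
      toℕ t % M                         ∎

  Next : ℕ → ℕ → Set
  Next a b = b ≡ suc a ⊎ (suc a ≡ M × b ≡ 0)

  Consecutive : ℕ → ℕ → Set
  Consecutive a b = Next a b ⊎ Next b a

  cv-step : ∀ x → cyc M (suc (toℕ (x mod M))) ≡ cv (suc x)
  cv-step x = trans (cong (λ r → cv (suc r)) (toℕ-mod x))
                    (cv-cong (suc (x % M)) (suc x) (+-congʳ-mod 1 (x % M) x (m%n%n≡m%n x M)))

  adjacent-next : ∀ z a → Adj M (cv (z + a)) (cv (z + suc a))
  adjacent-next z a = inj₁ (trans (cv-step (z + a)) (cong cv (sym (+-suc z a))))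

  adjacent-prev : ∀ z a → Adj M (cv (z + suc a)) (cv (z + a))
  adjacent-prev z a = inj₂ (trans (cv-step (z + a)) (cong cv (sym (+-suc z a))))

  next-offset : ∀ z {a b} → a < M → b < M → cv (z + suc a) ≡ cv (z + b) → Next a b
  next-offset z {a} {b} a<M b<M same with m≤n⇒m<n∨m≡n a<M
  ... | inj₁ 1+a<M = inj₁ (sym (offset-injective z 1+a<M b<M same))
  ... | inj₂ 1+a≡M = inj₂ (1+a≡M , sym (offset-injective z z<s b<M z+0≡z+b))
    where
    open ≡-Reasoning
    z+0≡z+b : cv (z + 0) ≡ cv (z + b)
    z+0≡z+b = begin
      cv (z + 0)      ≡⟨ cong cv (+-identityʳ z) ⟩
      cv z            ≡⟨ cv-+M z ⟨
      cv (z + M)      ≡⟨ cong (λ t → cv (z + t)) 1+a≡M ⟨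
      cv (z + suc a)  ≡⟨ same ⟩
      cv (z + b)      ∎

  adjacent-offsets : ∀ z {a b} → a < M → b < M → Adj M (cv (z + a)) (cv (z + b)) → Consecutive a b
  adjacent-offsets z {a} {b} a<M b<M (inj₁ a→b) =
    inj₁ (next-offset z a<M b<M (trans (cong cv (+-suc z a)) (trans (sym (cv-step (z + a))) a→b)))
  adjacent-offsets z {a} {b} a<M b<M (inj₂ b→a) =
    inj₂ (next-offset z b<M a<M (trans (cong cv (+-suc z b)) (trans (sym (cv-step (z + b))) b→a)))

  far-apart : ∀ {a b} → suc a < b → suc b < a + M → ¬ Consecutive a b
  far-apart 1+a<b _ (inj₁ (inj₁ b≡1+a))      = <-irrefl (sym b≡1+a) 1+a<b
  far-apart 1+a<b _ (inj₁ (inj₂ (_ , refl))) = n≮0 1+a<b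
  far-apart {a} {b} 1+a<b _ (inj₂ (inj₁ refl)) = <-asym (<-trans (n<1+n a) 1+a<b) (n<1+n b)
  far-apart _ 1+b<M (inj₂ (inj₂ (1+b≡M , refl))) = <-irrefl 1+b≡M 1+b<M

  Spread : Subset (suc M) → Set
  Spread L = ∀ y e → 1 ≤ e → e ≤ 4 → cv y ∉ L → cv (y + e) ∈ L

  cond⇒spread : ∀ L → Cond M L → Spread L
  cond⇒spread L cond y e 1≤e e≤4 y∉L =
    subst (_∈ L) (trans (cong (λ r → cv (r + e)) (toℕ-mod y)) (cv-reduce y e))
          (proj₁ (cond (y mod M) y∉L e 1≤e e≤4))

  spread⇒cond : 4 ≤ M → ∀ L → Spread L → Cond M L
  spread⇒cond 4≤M L spread i i∉L j 1≤j j≤4 = spread (toℕ i) j 1≤j j≤4 ci∉L , before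
    where
    ci∉L : cv (toℕ i) ∉ L
    ci∉L = subst (_∉ L) (suc≡cv i) i∉L
    back : cv (toℕ i + (M ∸ j) + j) ≡ cv (toℕ i)
    back = trans (cong cv (trans (+-assoc (toℕ i) (M ∸ j) j) (cong (toℕ i +_) (m∸n+n≡m (≤-trans j≤4 4≤M)))))
                 (cv-+M (toℕ i))
    -- c_{i-j} is in L, for otherwise c_i = c_{(i-j)+j} would be
    before : cv (toℕ i + (M ∸ j)) ∈ L
    before with cv (toℕ i + (M ∸ j)) ∈? L
    ... | yes i-j∈L = i-j∈L
    ... | no i-j∉L  = ⊥-elim (ci∉L (subst (_∈ L) back (spread (toℕ i + (M ∸ j)) j 1≤j j≤4 i-j∉L)))

  wrap-bound : ∀ a {b} → b < M → suc b < suc a + M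
  wrap-bound a b<M = s≤s (≤-trans b<M (m≤n+m M a))

module Distances (k : ℕ) where
  open Cycle k

  walk-length-0 : ∀ {u v} → Walk M u v 0 → u ≡ v
  walk-length-0 here = refl

  walk-length-1 : ∀ {u v} → Walk M u v 1 → Adj M u v
  walk-length-1 (step u~v here) = u~v

  dist-unique : ∀ {u v a b} → IsDist M u v a → IsDist M u v b → a ≡ b
  dist-unique {a = a} {b} (walk-a , shortest-a) (walk-b , shortest-b) with <-cmp a b
  ... | tri< a<b _ _ = ⊥-elim (shortest-b a a<b walk-a)
  ... | tri≈ _ a≡b _ = a≡b
  ... | tri> _ _ b<a = ⊥-elim (shortest-a b b<a walk-b)

  dist-self : ∀ {u} → IsDist M u u 0
  dist-self = here , λ _ ()

  dist-adjacent : ∀ {u v} → u ≢ v → Adj M u v → IsDist M u v 1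
  dist-adjacent u≢v u~v = step u~v here , λ { zero _ w → u≢v (walk-length-0 w) ; (suc _) (s≤s ()) }

  dist-to-hub : ∀ {i} → IsDist M (suc i) zero 1
  dist-to-hub = dist-adjacent (λ ()) _

  dist-from-hub : ∀ {i} → IsDist M zero (suc i) 1
  dist-from-hub = dist-adjacent (λ ()) _

  dist-apart : ∀ {i j} → suc i ≢ suc j → ¬ Adj M (suc i) (suc j) → IsDist M (suc i) (suc j) 2
  dist-apart i≢j i≁j = step {w = zero} _ (step _ here) , shorter
    where
    shorter : ∀ l → l < 2 → ¬ Walk M _ _ l
    shorter zero       _ w = i≢j (walk-length-0 w)
    shorter (suc zero) _ w = i≁j (walk-length-1 w)
    shorter (suc (suc _)) (s≤s (s≤s ()))

  separates : ∀ {τ u v p q} → IsDist M u τ p → IsDist M v τ q → p ≢ q → Separates M τ u v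
  separates du dv p≢q a b da db a≡b = p≢q (trans (dist-unique du da) (trans a≡b (dist-unique db dv)))

  not-separates : ∀ {τ u v p} → IsDist M u τ p → IsDist M v τ p → ¬ Separates M τ u v
  not-separates du dv sep = sep _ _ du dv refl

  separates-sym : ∀ {τ u v} → Separates M τ u v → Separates M τ v u
  separates-sym sep a b da db a≡b = sep b a db da (sym a≡b)

  dist-next : ∀ z a → suc a < M → IsDist M (cv (z + a)) (cv (z + suc a)) 1
  dist-next z a 1+a<M = dist-adjacent (offset-distinct z (n<1+n a) 1+a<M) (adjacent-next z a)

  dist-prev : ∀ z a → suc a < M → IsDist M (cv (z + suc a)) (cv (z + a)) 1
  dist-prev z a 1+a<M = dist-adjacent (≢-sym (offset-distinct z (n<1+n a) 1+a<M)) (adjacent-prev z a)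

  dist-far : ∀ z {a b} → suc a < b → suc b < a + M → b < M → IsDist M (cv (z + a)) (cv (z + b)) 2
  dist-far z {a} {b} 1+a<b 1+b<a+M b<M = dist-apart (offset-distinct z a<b b<M)
    (λ adj → far-apart 1+a<b 1+b<a+M (adjacent-offsets z (<-trans a<b b<M) b<M adj))
    where
    a<b : a < b
    a<b = <-trans (n<1+n a) 1+a<b

  dist-far-back : ∀ z {a b} → suc a < b → suc b < a + M → b < M → IsDist M (cv (z + b)) (cv (z + a)) 2
  dist-far-back z {a} {b} 1+a<b 1+b<a+M b<M = dist-apart (≢-sym (offset-distinct z a<b b<M))
    (λ adj → far-apart 1+a<b 1+b<a+M (swap (adjacent-offsets z b<M (<-trans a<b b<M) adj)))
    where
    a<b : a < b
    a<b = <-trans (n<1+n a) 1+a<b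

module Counting (k : ℕ) where
  open Cycle k

  gaps : Subset (suc M) → ℕ → ℕ
  gaps L s = uncovered (lookup L (cv s))

  gaps-∈ : ∀ L y → cv y ∈ L → gaps L y ≡ 0
  gaps-∈ L y y∈L = cong uncovered ([]=⇒lookup y∈L)

  gaps≤1 : ∀ L y → gaps L y ≤ 1
  gaps≤1 L y with lookup L (cv y)
  ... | true  = z≤n
  ... | false = ≤-refl

  gaps-periodic : ∀ L s → gaps L (s + M) ≡ gaps L s
  gaps-periodic L s = cong (λ v → uncovered (lookup L v)) (cv-+M s)

  window : ∀ L → Spread L → ∀ s ℓ → ℓ ≤ 5 → sum< ℓ (λ j → gaps L (s + j)) ≤ 1
  window L spread s zero    _     = z≤n
  window L spread s (suc ℓ) 1+ℓ≤5 with cv s ∈? L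
  ... | yes s∈L = begin
    gaps L (s + 0) + sum< ℓ (λ j → gaps L (s + suc j))
      ≡⟨ cong₂ _+_ (trans (cong (gaps L) (+-identityʳ s)) (gaps-∈ L s s∈L))
                   (sum<-cong ℓ (λ j _ → cong (gaps L) (+-suc s j))) ⟩
    sum< ℓ (λ j → gaps L (suc s + j))
      ≤⟨ window L spread (suc s) ℓ (≤-trans (n≤1+n ℓ) 1+ℓ≤5) ⟩
    1 ∎
    where open ≤-Reasoning
  ... | no s∉L = begin
    gaps L (s + 0) + sum< ℓ (λ j → gaps L (s + suc j))
      ≡⟨ cong (gaps L (s + 0) +_) (trans (sum<-cong ℓ rest-covered) (trans (sum<-const ℓ 0) (*-zeroʳ ℓ))) ⟩
    gaps L (s + 0) + 0 ≡⟨ +-identityʳ _ ⟩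
    gaps L (s + 0)     ≤⟨ gaps≤1 L (s + 0) ⟩
    1 ∎
    where
    open ≤-Reasoning
    -- after a gap, the next four vertices are covered
    rest-covered : ∀ j → j < ℓ → gaps L (s + suc j) ≡ 0
    rest-covered j j<ℓ = gaps-∈ L (s + suc j) (spread s (suc j) (s≤s z≤n) (≤-trans j<ℓ (s≤s⁻¹ 1+ℓ≤5)) s∉L)

  -- summing the window bound over all M windows counts every gap five times
  few-gaps : ∀ L → Spread L → 5 * sum< M (gaps L) ≤ M
  few-gaps L spread = begin
    5 * sum< M (gaps L)                           ≡⟨ sum<-const 5 (sum< M (gaps L)) ⟨
    sum< 5 (λ _ → sum< M (gaps L))                ≡⟨ sum<-cong 5 (λ j _ → sum<-rotate M (gaps L) (gaps-periodic L) j) ⟨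
    sum< 5 (λ j → sum< M (λ s → gaps L (s + j)))  ≡⟨ sum<-swap M 5 (λ s j → gaps L (s + j)) ⟨
    sum< M (λ s → sum< 5 (λ j → gaps L (s + j)))  ≤⟨ sum<-mono M (λ s → window L spread s 5 ≤-refl) ⟩
    sum< M (λ _ → 1)                              ≡⟨ sum<-const M 1 ⟩
    M * 1                                         ≡⟨ *-identityʳ M ⟩
    M                                             ∎
    where open ≤-Reasoning

  size+gaps : ∀ h (L : Subset M) → ∣ L ∣ + sum< M (gaps (h ∷ L)) ≡ M
  size+gaps h L = size+uncovered L (λ s → lookup (h ∷ L) (cv s)) (λ i → cong (lookup (h ∷ L)) (sym (suc≡cv i)))

  -- a spread set has at least ⌊4(M+1)/5⌋ elements: it misses at most ⌊M/5⌋ cycle vertices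
  spread-size : ∀ L → Spread L → (4 * suc M) / 5 ≤ ∣ L ∣
  spread-size (h ∷ L) spread = ≤-trans (+-cancelʳ-≤ (M / 5) _ _ bound) (∣p∣≤∣x∷p∣ h L)
    where
    X : ℕ
    X = sum< M (gaps (h ∷ L))
    X≤M/5 : X ≤ M / 5
    X≤M/5 = subst (_≤ M / 5) (m*n/n≡m X 5) (/-monoˡ-≤ 5 (subst (_≤ M) (*-comm 5 X) (few-gaps (h ∷ L) spread)))
    open ≤-Reasoning
    bound : (4 * suc M) / 5 + M / 5 ≤ ∣ L ∣ + M / 5
    bound = begin
      (4 * suc M) / 5 + M / 5 ≡⟨ four-fifths M ⟩
      M                       ≡⟨ size+gaps h L ⟨
      ∣ L ∣ + X               ≤⟨ +-monoʳ-≤ ∣ L ∣ X≤M/5 ⟩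
      ∣ L ∣ + M / 5           ∎

  fifths : ℕ → ℕ → Bool
  fifths zero    _                                 = true
  fifths (suc q) 0                                 = false
  fifths (suc q) 1                                 = true
  fifths (suc q) 2                                 = true
  fifths (suc q) 3                                 = true
  fifths (suc q) 4                                 = true
  fifths (suc q) (suc (suc (suc (suc (suc s))))) = fifths q s

  fifths-count : ∀ q ℓ → q * 5 ≤ ℓ → sum< ℓ (λ s → uncovered (fifths q s)) ≡ q
  fifths-count zero    ℓ _ = trans (sum<-const ℓ 0) (*-zeroʳ ℓ)
  fifths-count (suc q) (suc (suc (suc (suc (suc ℓ))))) (s≤s (s≤s (s≤s (s≤s (s≤s 5q≤ℓ))))) =
    cong suc (fifths-count q ℓ 5q≤ℓ)

  fifths-gap-bound : ∀ q t → fifths q t ≡ false → t + 5 ≤ q * 5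
  fifths-gap-bound (suc q) 0 _ = s≤s (s≤s (s≤s (s≤s (s≤s z≤n))))
  fifths-gap-bound (suc q) (suc (suc (suc (suc (suc t))))) gap =
    s≤s (s≤s (s≤s (s≤s (s≤s (fifths-gap-bound q t gap)))))

  fifths-next : ∀ q t e → fifths q t ≡ false → 1 ≤ e → e ≤ 4 → fifths q (t + e) ≡ true
  fifths-next (suc q) 0 1 _ _ _ = refl
  fifths-next (suc q) 0 2 _ _ _ = refl
  fifths-next (suc q) 0 3 _ _ _ = refl
  fifths-next (suc q) 0 4 _ _ _ = refl
  fifths-next (suc q) 0 (suc (suc (suc (suc (suc _))))) _ _ (s≤s (s≤s (s≤s (s≤s ()))))
  fifths-next (suc q) (suc (suc (suc (suc (suc t))))) e gap = fifths-next q t e gap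

  optimal-bits : Fin M → Bool
  optimal-bits i = fifths (M / 5) (toℕ i)

  optimal : Subset (suc M)
  optimal = false ∷ tabulate optimal-bits

  optimal-lookup : ∀ y → lookup optimal (cv y) ≡ fifths (M / 5) (y % M)
  optimal-lookup y = trans (lookup∘tabulate optimal-bits (y mod M)) (cong (fifths (M / 5)) (toℕ-mod y))

  -- the optimal set is spread: gaps are five apart and none wraps around
  optimal-spread : Spread optimal
  optimal-spread y e 1≤e e≤4 y∉optimal = lookup⇒[]= (cv (y + e)) optimal (begin
    lookup optimal (cv (y + e))  ≡⟨ optimal-lookup (y + e) ⟩
    fifths (M / 5) ((y + e) % M) ≡⟨ cong (fifths (M / 5)) (+-congˡ-mod (y % M) y e (m%n%n≡m%n y M)) ⟨
    fifths (M / 5) ((y % M + e) % M) ≡⟨ cong (fifths (M / 5)) (m<n⇒m%n≡m no-wrap) ⟩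
    fifths (M / 5) (y % M + e)   ≡⟨ fifths-next (M / 5) (y % M) e gap 1≤e e≤4 ⟩
    true                         ∎)
    where
    open ≡-Reasoning
    gap : fifths (M / 5) (y % M) ≡ false
    gap with fifths (M / 5) (y % M) in eq
    ... | false = refl
    ... | true  = ⊥-elim (y∉optimal (lookup⇒[]= (cv y) optimal (trans (optimal-lookup y) eq)))
    no-wrap : y % M + e < M
    no-wrap = <-≤-trans (+-monoʳ-< (y % M) (s≤s e≤4))
                        (≤-trans (fifths-gap-bound (M / 5) (y % M) gap) (m/n*n≤m M 5))

  optimal-size : ∣ optimal ∣ ≡ (4 * suc M) / 5
  optimal-size = +-cancelʳ-≡ (M / 5) _ _ (begin
    ∣ optimal ∣ + M / 5
      ≡⟨ cong (∣ optimal ∣ +_) (fifths-count (M / 5) M (m/n*n≤m M 5)) ⟨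
    ∣ optimal ∣ + sum< M (λ s → uncovered (fifths (M / 5) s))
      ≡⟨ size+uncovered (tabulate optimal-bits) (fifths (M / 5)) (λ i → sym (lookup∘tabulate optimal-bits i)) ⟩
    M
      ≡⟨ four-fifths M ⟨
    (4 * suc M) / 5 + M / 5 ∎)
    where open ≡-Reasoning

-- The wheel whose cycle has length M = 6 + n.
module Wheel (n : ℕ) where
  open Cycle (5 + n) public
  open Distances (5 + n)

  ThreeSeparators : Subset (suc M) → V M → V M → Set
  ThreeSeparators L u v =
    Σ (Fin 3 → V M) λ f → Injective _≡_ _≡_ f × (∀ t → (f t ∈ L) × Separates M (f t) u v)

  three-separators-sym : ∀ {L u v} → ThreeSeparators L u v → ThreeSeparators L v u
  three-separators-sym (f , f-injective , f-sep) =
    f , f-injective , λ t → proj₁ (f-sep t) , separates-sym (proj₂ (f-sep t))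

  cv-0 : ∀ x → cv x ≡ cv (x + 0)
  cv-0 x = cong cv (sym (+-identityʳ x))

  at-0 : ∀ (t : Fin M) → suc t ≡ cv (toℕ t + 0)
  at-0 t = trans (suc≡cv t) (cv-0 (toℕ t))

  module Around (L : Subset (suc M)) (spread : Spread L) (z : ℕ) (u v : V M) where

    In : ℕ → Set
    In a = cv (z + a) ∈ L

    Sep : ℕ → Set
    Sep a = Separates M (cv (z + a)) u v

    covers : ∀ {a b} → a < b → b ≤ a + 4 → ¬ In a → In b
    covers {a} {b} a<b b≤a+4 a∉L =
      subst (_∈ L) (cong cv z+a+[b-a]≡z+b) (spread (z + a) (b ∸ a) (m<n⇒0<n∸m a<b) (m≤n+o⇒m∸n≤o b a b≤a+4) a∉L)
      where
      z+a+[b-a]≡z+b : z + a + (b ∸ a) ≡ z + b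
      z+a+[b-a]≡z+b = trans (+-assoc z a (b ∸ a)) (cong (z +_) (m+[n∸m]≡n (<⇒≤ a<b)))

    three : ∀ {a b c} → a < b → b < c → c < M → In a → In b → In c → Sep a → Sep b → Sep c →
            ThreeSeparators L u v
    three {a} {b} {c} a<b b<c c<M a∈L b∈L c∈L sa sb sc = f , f-injective , f-sep
      where
      f : Fin 3 → V M
      f zero             = cv (z + a)
      f (suc zero)       = cv (z + b)
      f (suc (suc zero)) = cv (z + c)
      a≢b : cv (z + a) ≢ cv (z + b)
      a≢b = offset-distinct z a<b (<-trans b<c c<M)
      a≢c : cv (z + a) ≢ cv (z + c)
      a≢c = offset-distinct z (<-trans a<b b<c) c<M
      b≢c : cv (z + b) ≢ cv (z + c)
      b≢c = offset-distinct z b<c c<M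
      f-injective : Injective _≡_ _≡_ f
      f-injective {zero}             {zero}             _ = refl
      f-injective {suc zero}         {suc zero}         _ = refl
      f-injective {suc (suc zero)}   {suc (suc zero)}   _ = refl
      f-injective {zero}             {suc zero}         e = ⊥-elim (a≢b e)
      f-injective {zero}             {suc (suc zero)}   e = ⊥-elim (a≢c e)
      f-injective {suc zero}         {suc (suc zero)}   e = ⊥-elim (b≢c e)
      f-injective {suc zero}         {zero}             e = ⊥-elim (a≢b (sym e))
      f-injective {suc (suc zero)}   {zero}             e = ⊥-elim (a≢c (sym e))
      f-injective {suc (suc zero)}   {suc zero}         e = ⊥-elim (b≢c (sym e))
      f-sep : ∀ t → (f t ∈ L) × Separates M (f t) u v
      f-sep zero             = a∈L , sa
      f-sep (suc zero)       = b∈L , sb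
      f-sep (suc (suc zero)) = c∈L , sc

    -- four candidates in the window z, …, z + 4: three of them are in L
    window-of-four : ∀ {b c d} → 0 < b → b < c → c < d → d ≤ 4 →
                     Sep 0 → Sep b → Sep c → Sep d → ThreeSeparators L u v
    window-of-four {b} {c} {d} 0<b b<c c<d d≤4 s0 sb sc sd =
      choose (cv (z + 0) ∈? L) (cv (z + b) ∈? L) (cv (z + c) ∈? L)
      where
      c≤4 : c ≤ 4
      c≤4 = <⇒≤ (<-≤-trans c<d d≤4)
      b≤4 : b ≤ 4
      b≤4 = <⇒≤ (<-≤-trans b<c c≤4)
      d<M : d < M
      d<M = ≤-<-trans d≤4 by-evaluation
      c<M : c < M
      c<M = <-trans c<d d<M
      b<d : b < d
      b<d = <-trans b<c c<d
      choose : Dec (In 0) → Dec (In b) → Dec (In c) → ThreeSeparators L u v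
      choose (no 0∉L) _ _ =
        three b<c c<d d<M (covers 0<b b≤4 0∉L) (covers (<-trans 0<b b<c) c≤4 0∉L)
                          (covers (<-trans 0<b b<d) d≤4 0∉L) sb sc sd
      choose (yes 0∈L) (no b∉L) _ =
        three (<-trans 0<b b<c) c<d d<M 0∈L (covers b<c (≤-trans c≤4 (m≤n+m 4 b)) b∉L)
                                           (covers b<d (≤-trans d≤4 (m≤n+m 4 b)) b∉L) s0 sc sd
      choose (yes 0∈L) (yes b∈L) (yes c∈L) = three 0<b b<c c<M 0∈L b∈L c∈L s0 sb sc
      choose (yes 0∈L) (yes b∈L) (no c∉L)  =
        three 0<b b<d d<M 0∈L b∈L (covers c<d (≤-trans d≤4 (m≤n+m 4 c)) c∉L) s0 sb sd

    -- two of z, z + 1, z + 2 are in L; with one more landmark c beyond them, three separators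
    two-near-one-far : ∀ {c} → 2 < c → c < M → In c → Sep 0 → Sep 1 → Sep 2 → Sep c →
                       ThreeSeparators L u v
    two-near-one-far 2<c c<M c∈L s0 s1 s2 sc with cv (z + 0) ∈? L | cv (z + 1) ∈? L
    ... | no 0∉L  | _        = three by-evaluation 2<c c<M (covers by-evaluation by-evaluation 0∉L)
                                     (covers by-evaluation by-evaluation 0∉L) c∈L s1 s2 sc
    ... | yes 0∈L | no 1∉L   = three by-evaluation 2<c c<M 0∈L (covers by-evaluation by-evaluation 1∉L)
                                     c∈L s0 s2 sc
    ... | yes 0∈L | yes 1∈L  = three by-evaluation (<-trans by-evaluation 2<c) c<M 0∈L 1∈L c∈L s0 s1 sc

    far-window : ∀ {c} → 2 < c → suc c < M → Sep 0 → Sep 1 → Sep 2 → Sep c → Sep (suc c) →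
                 ThreeSeparators L u v
    far-window {c} 2<c 1+c<M s0 s1 s2 sc sc+1 with cv (z + c) ∈? L
    ... | yes c∈L = two-near-one-far 2<c (<-trans (n<1+n c) 1+c<M) c∈L s0 s1 s2 sc
    ... | no c∉L  = two-near-one-far (<-trans 2<c (n<1+n c)) 1+c<M
                      (covers (n<1+n c) (subst (_≤ c + 4) (+-comm c 1) (+-monoʳ-≤ c by-evaluation)) c∉L)
                      s0 s1 s2 sc+1

  long-offset : ∀ p → 3 + p < M → p ≤ n ⊎ (p ≡ suc n ⊎ p ≡ suc (suc n))
  long-offset p (s≤s (s≤s (s≤s (s≤s p≤2+n)))) with p ≤? n | p ≤? suc n
  ... | yes p≤n | _         = inj₁ p≤n
  ... | no p≰n  | yes p≤1+n = inj₂ (inj₁ (≤-antisym p≤1+n (≰⇒> p≰n)))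
  ... | no _    | no p≰1+n  = inj₂ (inj₂ (≤-antisym p≤2+n (≰⇒> p≰1+n)))

  -- Sufficiency: every pair of vertices has three separators in a spread set.
  -- Each candidate is shown to separate by its two (different) distances to the pair.
  module Sufficient (L : Subset (suc M)) (spread : Spread L) where

    -- the hub and c_x: separated by c_x, c_{x+2}, c_{x+3}, c_{x+4}
    hub-cycle : ∀ x → ThreeSeparators L zero (cv (x + 0))
    hub-cycle x = window-of-four {2} {3} {4} by-evaluation by-evaluation by-evaluation by-evaluation
      (separates dist-from-hub dist-self (λ ()))
      (separates dist-from-hub (dist-far x by-evaluation by-evaluation by-evaluation) (λ ()))
      (separates dist-from-hub (dist-far x by-evaluation by-evaluation by-evaluation) (λ ()))
      (separates dist-from-hub (dist-far x by-evaluation by-evaluation by-evaluation) (λ ()))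
      where open Around L spread x zero (cv (x + 0))

    -- neighbours c_{z+1}, c_{z+2}: separated by c_z, …, c_{z+3}
    adjacent-pair : ∀ z → ThreeSeparators L (cv (z + 1)) (cv (z + 2))
    adjacent-pair z = window-of-four {1} {2} {3} by-evaluation by-evaluation by-evaluation by-evaluation
      (separates (dist-prev z 0 by-evaluation) (dist-far-back z by-evaluation by-evaluation by-evaluation) (λ ()))
      (separates dist-self (dist-prev z 1 by-evaluation) (λ ()))
      (separates (dist-next z 1 by-evaluation) dist-self (λ ()))
      (separates (dist-far z by-evaluation by-evaluation by-evaluation) (dist-next z 2 by-evaluation) (λ ()))
      where open Around L spread z (cv (z + 1)) (cv (z + 2))

    -- c_{z+1}, c_{z+3}: separated by c_z, c_{z+1}, c_{z+3}, c_{z+4}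
    gap-two-pair : ∀ z → ThreeSeparators L (cv (z + 1)) (cv (z + 3))
    gap-two-pair z = window-of-four {1} {3} {4} by-evaluation by-evaluation by-evaluation by-evaluation
      (separates (dist-prev z 0 by-evaluation) (dist-far-back z by-evaluation by-evaluation by-evaluation) (λ ()))
      (separates dist-self (dist-far-back z by-evaluation by-evaluation by-evaluation) (λ ()))
      (separates (dist-far z by-evaluation by-evaluation by-evaluation) dist-self (λ ()))
      (separates (dist-far z by-evaluation by-evaluation by-evaluation) (dist-next z 3 by-evaluation) (λ ()))
      where open Around L spread z (cv (z + 1)) (cv (z + 3))

    -- c_{z+1}, c_{z+4+p} at least three apart both ways: separated by
    -- c_z, c_{z+1}, c_{z+2} and c_{z+3+p}, c_{z+4+p}
    distant-pair : ∀ z p → p ≤ n → ThreeSeparators L (cv (z + 1)) (cv (z + (4 + p)))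
    distant-pair z p p≤n = far-window by-evaluation 4+p<M
      (separates (dist-prev z 0 by-evaluation) (dist-far-back z by-evaluation 5+p<M 4+p<M) (λ ()))
      (separates dist-self (dist-far-back z by-evaluation (wrap-bound 0 4+p<M) 4+p<M) (λ ()))
      (separates (dist-next z 1 by-evaluation) (dist-far-back z by-evaluation (wrap-bound 1 4+p<M) 4+p<M) (λ ()))
      (separates (dist-far z by-evaluation (wrap-bound 0 3+p<M) 3+p<M) (dist-prev z (3 + p) 4+p<M) (λ ()))
      (separates (dist-far z by-evaluation (wrap-bound 0 4+p<M) 4+p<M) dist-self (λ ()))
      where
      open Around L spread z (cv (z + 1)) (cv (z + (4 + p)))
      5+p<M : 5 + p < M
      5+p<M = +-monoʳ-≤ 6 p≤n
      4+p<M : 4 + p < M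
      4+p<M = <-trans (n<1+n (4 + p)) 5+p<M
      3+p<M : 3 + p < M
      3+p<M = <-trans (n<1+n (3 + p)) 4+p<M

    from-base : ∀ o → (∀ z → ThreeSeparators L (cv (z + 1)) (cv (z + suc o))) →
                ∀ x → ThreeSeparators L (cv (x + 0)) (cv (x + o))
    from-base o pair x =
      subst₂ (ThreeSeparators L) (sym (cv-rebase x 0)) (sym (cv-rebase x o)) (pair (x + (5 + n)))

    -- two cycle vertices: choose the base so that one of the pair lemmas applies
    -- (when j is M - 2 or M - 1 steps after i, i is 2 or 1 steps after j)
    cycle-pair : ∀ (i j : Fin M) → suc i ≢ suc j → ThreeSeparators L (suc i) (suc j)
    cycle-pair i j i≢j with offset-surjective (toℕ i) j
    ... | 0 , _ , j≡i+0 = ⊥-elim (i≢j (trans (at-0 i) (sym j≡i+0)))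
    ... | 1 , _ , j≡i+1 =
      subst₂ (ThreeSeparators L) (sym (at-0 i)) (sym j≡i+1) (from-base 1 adjacent-pair (toℕ i))
    ... | 2 , _ , j≡i+2 =
      subst₂ (ThreeSeparators L) (sym (at-0 i)) (sym j≡i+2) (from-base 2 gap-two-pair (toℕ i))
    ... | suc (suc (suc p)) , 3+p<M , j≡i+o with long-offset p 3+p<M
    ...   | inj₁ p≤n =
      subst₂ (ThreeSeparators L) (sym (at-0 i)) (sym j≡i+o) (from-base (3 + p) (λ z → distant-pair z p p≤n) (toℕ i))
    ...   | inj₂ (inj₁ refl) = three-separators-sym (subst₂ (ThreeSeparators L) (sym (at-0 j))
      (trans (cv-wrap (toℕ i) _ 2 j (cong (4 +_) (+-comm n 2)) j≡i+o) (sym (at-0 i)))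
      (from-base 2 gap-two-pair (toℕ j)))
    ...   | inj₂ (inj₂ refl) = three-separators-sym (subst₂ (ThreeSeparators L) (sym (at-0 j))
      (trans (cv-wrap (toℕ i) _ 1 j (cong (5 +_) (+-comm n 1)) j≡i+o) (sym (at-0 i)))
      (from-base 1 adjacent-pair (toℕ j)))

    spread⇒landmark : IsAPLandmark M 3 L
    spread⇒landmark zero    zero    u≢v = ⊥-elim (u≢v refl)
    spread⇒landmark zero    (suc j) _   = subst (ThreeSeparators L zero) (sym (at-0 j)) (hub-cycle (toℕ j))
    spread⇒landmark (suc i) zero    _   =
      three-separators-sym (subst (ThreeSeparators L zero) (sym (at-0 i)) (hub-cycle (toℕ i)))
    spread⇒landmark (suc i) (suc j) u≢v = cycle-pair i j u≢v

  adjacent-separators : ∀ z τ → Separates M τ (cv (z + 1)) (cv (z + 2)) →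
                        (τ ≡ cv (z + 1) ⊎ τ ≡ cv (z + 2)) ⊎ (τ ≡ cv (z + 0) ⊎ τ ≡ cv (z + 3))
  adjacent-separators z zero    sep = ⊥-elim (not-separates dist-to-hub dist-to-hub sep)
  adjacent-separators z (suc t) sep with offset-surjective z t
  ... | 0 , _ , τ≡ = inj₂ (inj₁ τ≡)
  ... | 1 , _ , τ≡ = inj₁ (inj₁ τ≡)
  ... | 2 , _ , τ≡ = inj₁ (inj₂ τ≡)
  ... | 3 , _ , τ≡ = inj₂ (inj₂ τ≡)
  ... | suc (suc (suc (suc p))) , o<M , τ≡ = ⊥-elim (not-separates
        (dist-far z by-evaluation (wrap-bound 0 o<M) o<M) (dist-far z by-evaluation (wrap-bound 1 o<M) o<M)
        (subst (λ τ → Separates M τ (cv (z + 1)) (cv (z + 2))) τ≡ sep))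

  gap-two-separators : ∀ z τ → Separates M τ (cv (z + 1)) (cv (z + 3)) →
                       (τ ≡ cv (z + 1) ⊎ τ ≡ cv (z + 3)) ⊎ (τ ≡ cv (z + 0) ⊎ τ ≡ cv (z + 4))
  gap-two-separators z zero    sep = ⊥-elim (not-separates dist-to-hub dist-to-hub sep)
  gap-two-separators z (suc t) sep with offset-surjective z t
  ... | 0 , _ , τ≡ = inj₂ (inj₁ τ≡)
  ... | 1 , _ , τ≡ = inj₁ (inj₁ τ≡)
  ... | 2 , _ , τ≡ = ⊥-elim (not-separates (dist-next z 1 by-evaluation) (dist-prev z 2 by-evaluation)
        (subst (λ τ → Separates M τ (cv (z + 1)) (cv (z + 3))) τ≡ sep))
  ... | 3 , _ , τ≡ = inj₁ (inj₂ τ≡)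
  ... | 4 , _ , τ≡ = inj₂ (inj₂ τ≡)
  ... | suc (suc (suc (suc (suc p)))) , o<M , τ≡ = ⊥-elim (not-separates
        (dist-far z by-evaluation (wrap-bound 0 o<M) o<M) (dist-far z by-evaluation (wrap-bound 2 o<M) o<M)
        (subst (λ τ → Separates M τ (cv (z + 1)) (cv (z + 3))) τ≡ sep))

  module Necessary (L : Subset (suc M)) where

    too-few-separators : ∀ {u v o₁ o₂ a b} →
      (∀ τ → Separates M τ u v → (τ ≡ o₁ ⊎ τ ≡ o₂) ⊎ (τ ≡ a ⊎ τ ≡ b)) →
      o₁ ∉ L → o₂ ∉ L → ¬ ThreeSeparators L u v
    too-few-separators {a = a} {b} located o₁∉L o₂∉L (f , f-injective , f-sep) =
      no-three-in-two f f-injective (λ t → in-L t (located (f t) (proj₂ (f-sep t))))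
      where
      in-L : ∀ t → _ ⊎ _ → f t ≡ a ⊎ f t ≡ b
      in-L t (inj₁ (inj₁ refl)) = ⊥-elim (o₁∉L (proj₁ (f-sep t)))
      in-L t (inj₁ (inj₂ refl)) = ⊥-elim (o₂∉L (proj₁ (f-sep t)))
      in-L t (inj₂ a-or-b)      = a-or-b

    ∉-0 : ∀ y → cv y ∉ L → cv (y + 0) ∉ L
    ∉-0 y = subst (_∉ L) (cv-0 y)

    ∉-rebase : ∀ y a → cv (y + a) ∉ L → cv (y + (5 + n) + suc a) ∉ L
    ∉-rebase y a = subst (_∉ L) (cv-rebase y a)

    close-gaps : ∀ y e → 1 ≤ e → e ≤ 4 → cv y ∉ L → cv (y + e) ∉ L →
                 ∃₂ λ u v → u ≢ v × ¬ ThreeSeparators L u v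
    close-gaps y 1 _ _ y∉L y+1∉L =
      _ , _ , offset-distinct z by-evaluation by-evaluation ,
      too-few-separators (adjacent-separators z) (∉-rebase y 0 (∉-0 y y∉L)) (∉-rebase y 1 y+1∉L)
      where
      z : ℕ
      z = y + (5 + n)
    close-gaps y 2 _ _ y∉L y+2∉L =
      _ , _ , offset-distinct z by-evaluation by-evaluation ,
      too-few-separators (gap-two-separators z) (∉-rebase y 0 (∉-0 y y∉L)) (∉-rebase y 2 y+2∉L)
      where
      z : ℕ
      z = y + (5 + n)
    close-gaps y 3 _ _ y∉L y+3∉L =
      _ , _ , offset-distinct y by-evaluation by-evaluation ,
      too-few-separators (λ τ sep → swap (adjacent-separators y τ sep)) (∉-0 y y∉L) y+3∉L
    close-gaps y 4 _ _ y∉L y+4∉L =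
      _ , _ , offset-distinct y by-evaluation by-evaluation ,
      too-few-separators (λ τ sep → swap (gap-two-separators y τ sep)) (∉-0 y y∉L) y+4∉L
    close-gaps y 0 () _ _ _
    close-gaps y (suc (suc (suc (suc (suc _))))) _ (s≤s (s≤s (s≤s (s≤s ())))) _ _

    landmark⇒spread : IsAPLandmark M 3 L → Spread L
    landmark⇒spread landmark y e 1≤e e≤4 y∉L with cv (y + e) ∈? L
    ... | yes y+e∈L = y+e∈L
    ... | no y+e∉L with close-gaps y e 1≤e e≤4 y∉L y+e∉L
    ...   | u , v , u≢v , too-few = ⊥-elim (too-few (landmark u v u≢v))

mainTheorem9 : (m : ℕ) → 6 ≤ m →
    ((L : Subset (suc m)) → zero ∉ L → (IsAPLandmark m 3 L → Cond m L) × (Cond m L → IsAPLandmark m 3 L))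
    × IsMdAP m 3 ((4 * suc m) / 5)
mainTheorem9 m 6≤m with m≤n⇒∃[o]m+o≡n 6≤m
... | n , refl = characterisation , (optimal , spread⇒landmark optimal optimal-spread , optimal-size) , lower-bound
  where
  open Wheel n
  open Counting (5 + n)
  open Sufficient using (spread⇒landmark)
  open Necessary using (landmark⇒spread)

  characterisation : (L : Subset (suc M)) → zero ∉ L →
                     (IsAPLandmark M 3 L → Cond M L) × (Cond M L → IsAPLandmark M 3 L)
  characterisation L _ = (λ landmark → spread⇒cond by-evaluation L (landmark⇒spread L landmark))
                       , (λ cond → spread⇒landmark L (cond⇒spread L cond))

  lower-bound : ∀ L → IsAPLandmark M 3 L → (4 * suc M) / 5 ≤ ∣ L ∣
  lower-bound L landmark = spread-size L (landmark⇒spread L landmark)
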